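{- Let $G_1$ and $G_2$ be graphs on disjoint vertex sets $V_1$ and $V_2$ with $n_1$ and $n_2$ vertices, respectively, and let $k\ge 2$. Then \[ \Delta_k(G_1+G_2)=\Delta_k(G_1*G_2)\cup\Delta_k(K_{n_1}+K_{n_2}), \] where $K_{n_1}$ and $K_{n_2}$ are the complete graphs on $V_1$ and $V_2$, respectively.
   Context: For a graph $G=(V,E)$ with $|V|=N$ and $k\ge 2$, the $k$-cut complex $\Delta_k(G)$ is the simplicial complex on $V$ whose facets are the subsets $F\subseteq V$ with $|F|=N-k$ such that the induced subgraph $G[V\setminus F]$ is disconnected. The disjoint union $G_1+G_2$ has vertex set $V_1\sqcup V_2$ and edge set $E_1\sqcup E_2$. The join $G_1*G_2$ is obtained from $G_1+G_2$ by adding all edges between a vertex of $V_1$ and a vertex of $V_2$. All three complexes are regarded as complexes on the vertex set $V_1\sqcup V_2$, and the union is the union of the sets of faces. -}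

module Defs where

open import Data.Bool using (Bool; true; false; not)
open import Data.Nat using (ℕ; _+_)
open import Data.Fin using (Fin; splitAt; _≟_)
open import Data.Fin.Subset using (Subset; _∈_; _⊆_; ∁; ∣_∣)
open import Data.Sum using (_⊎_; inj₁; inj₂)
open import Data.Product using (Σ; _×_)
open import Relation.Nullary using (¬_)
open import Relation.Nullary.Decidable using (⌊_⌋)
open import Relation.Binary.PropositionalEquality using (_≡_; refl; sym)

record Graph (n : ℕ) : Set where
  field
    adj   : Fin n → Fin n → Bool
    adj-sym : ∀ x y → adj x y ≡ adj y x
    irrefl : ∀ x → adj x x ≡ false
open Graph public

private
  ≟-sym : ∀ {n} (x y : Fin n) → ⌊ x ≟ y ⌋ ≡ ⌊ y ≟ x ⌋
  ≟-sym x y with x ≟ y | y ≟ x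
  ... | Relation.Nullary.yes _ | Relation.Nullary.yes _ = refl
  ... | Relation.Nullary.no _  | Relation.Nullary.no _  = refl
  ... | Relation.Nullary.yes p | Relation.Nullary.no q  = Data.Empty.⊥-elim (q (sym p))
    where import Data.Empty
  ... | Relation.Nullary.no p  | Relation.Nullary.yes q = Data.Empty.⊥-elim (p (sym q))
    where import Data.Empty

  ≟-refl : ∀ {n} (x : Fin n) → not ⌊ x ≟ x ⌋ ≡ false
  ≟-refl x with x ≟ x
  ... | Relation.Nullary.yes _ = refl
  ... | Relation.Nullary.no p  = Data.Empty.⊥-elim (p refl)
    where import Data.Empty

complete : (n : ℕ) → Graph n
complete n = record
  { adj = λ x y → not ⌊ x ≟ y ⌋
  ; adj-sym = λ x y → Relation.Binary.PropositionalEquality.cong not (≟-sym x y)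
  ; irrefl = ≟-refl }

-- Vertex set of G₁ + G₂ and G₁ * G₂ is Fin (n₁ + n₂); splitAt n₁ identifies
-- it with the disjoint union Fin n₁ ⊎ Fin n₂ (V₁ ⊔ V₂).
-- The parameter `cross` is the adjacency between V₁ and V₂.
private
  combAdj : ∀ {n₁ n₂} → Graph n₁ → Graph n₂ → Bool →
            Fin n₁ ⊎ Fin n₂ → Fin n₁ ⊎ Fin n₂ → Bool
  combAdj G₁ G₂ c (inj₁ a) (inj₁ b) = adj G₁ a b
  combAdj G₁ G₂ c (inj₂ a) (inj₂ b) = adj G₂ a b
  combAdj G₁ G₂ c (inj₁ a) (inj₂ b) = c
  combAdj G₁ G₂ c (inj₂ a) (inj₁ b) = c

  combSym : ∀ {n₁ n₂} (G₁ : Graph n₁) (G₂ : Graph n₂) c u v →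
            combAdj G₁ G₂ c u v ≡ combAdj G₁ G₂ c v u
  combSym G₁ G₂ c (inj₁ a) (inj₁ b) = Graph.adj-sym G₁ a b
  combSym G₁ G₂ c (inj₂ a) (inj₂ b) = Graph.adj-sym G₂ a b
  combSym G₁ G₂ c (inj₁ a) (inj₂ b) = refl
  combSym G₁ G₂ c (inj₂ a) (inj₁ b) = refl

  combIrr : ∀ {n₁ n₂} (G₁ : Graph n₁) (G₂ : Graph n₂) c u →
            combAdj G₁ G₂ c u u ≡ false
  combIrr G₁ G₂ c (inj₁ a) = irrefl G₁ a
  combIrr G₁ G₂ c (inj₂ a) = irrefl G₂ a

combine : ∀ {n₁ n₂} → Graph n₁ → Graph n₂ → Bool → Graph (n₁ + n₂)
combine {n₁} G₁ G₂ c = record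
  { adj = λ x y → combAdj G₁ G₂ c (splitAt n₁ x) (splitAt n₁ y)
  ; adj-sym = λ x y → combSym G₁ G₂ c (splitAt n₁ x) (splitAt n₁ y)
  ; irrefl = λ x → combIrr G₁ G₂ c (splitAt n₁ x) }

_⊕_ : ∀ {n₁ n₂} → Graph n₁ → Graph n₂ → Graph (n₁ + n₂)
G₁ ⊕ G₂ = combine G₁ G₂ false

_⊛_ : ∀ {n₁ n₂} → Graph n₁ → Graph n₂ → Graph (n₁ + n₂)
G₁ ⊛ G₂ = combine G₁ G₂ true

data Reach {n : ℕ} (G : Graph n) (S : Subset n) (u : Fin n) : Fin n → Set where
  here : u ∈ S → Reach G S u u
  step : ∀ {w v} → Reach G S u w → adj G w v ≡ true → v ∈ S → Reach G S u v

Connected : ∀ {n} → Graph n → Subset n → Set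
Connected G S = ∀ u v → u ∈ S → v ∈ S → Reach G S u v

Disconnected : ∀ {n} → Graph n → Subset n → Set
Disconnected G S = ¬ Connected G S

IsCutFacet : ∀ {n} → ℕ → Graph n → Subset n → Set
IsCutFacet {n} k G F = (∣ F ∣ + k ≡ n) × Disconnected G (∁ F)

CutFace : ∀ {n} → ℕ → Graph n → Subset n → Set
CutFace k G σ = Σ _ λ F → IsCutFacet k G F × σ ⊆ F

{-# OPTIONS --safe #-}
-- G₁ + G₂ is a spanning subgraph of both G₁ * G₂ and K_{n₁} + K_{n₂}, so a set
-- that is disconnected in either of them is disconnected in G₁ + G₂.  Conversely,
-- let S = V ∖ F be disconnected in G₁ + G₂.  If S lies inside one Vᵢ, then
-- G₁ * G₂ and G₁ + G₂ induce the same graph on S; otherwise S meets both V₁ and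
-- V₂, and no path of K_{n₁} + K_{n₂} joins them.  Facets of all three complexes
-- have the same size, so this comparison of disconnected sets is all there is.
module Submission where

open import Defs
open import Data.Bool using (Bool; true; false; not)
open import Data.Bool.Properties using (¬-not)
import Data.Bool.Properties as Bool
open import Data.Nat using (ℕ; _≤_; _+_)
open import Data.Fin using (Fin; splitAt; _≟_)
open import Data.Fin.Properties using (any?)
open import Data.Fin.Subset using (Subset; _∈_; ∁)
open import Data.Fin.Subset.Properties using (_∈?_)
open import Data.Product using (∃; ∃₂; _×_; _,_)
open import Data.Sum using (_⊎_; inj₁; inj₂; [_,_]; map)
open import Function using (const)
open import Function.Bundles using (_⇔_; mk⇔)
open import Relation.Nullary using (¬_; yes; no)
open import Relation.Nullary.Decidable using (_×-dec_)
open import Relation.Binary.PropositionalEquality using (_≡_; _≢_; refl; sym; trans)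

private
  variable
    n n₁ n₂ k : ℕ

_⊑[_]_ : Graph n → Subset n → Graph n → Set
G ⊑[ S ] H = ∀ {u v} → u ∈ S → v ∈ S → adj G u v ≡ true → adj H u v ≡ true

record _⊑_ (G H : Graph n) : Set where
  field ⊑-edge : ∀ {u v} → adj G u v ≡ true → adj H u v ≡ true
open _⊑_

⊑⇒⊑[_] : ∀ (S : Subset n) {G H : Graph n} → G ⊑ H → G ⊑[ S ] H
⊑⇒⊑[ S ] G⊑H _ _ = ⊑-edge G⊑H

Reach-∈ : ∀ {G : Graph n} {S u v} → Reach G S u v → v ∈ S
Reach-∈ (here v∈S)     = v∈S
Reach-∈ (step _ _ v∈S) = v∈S

Reach-mono : ∀ {G H : Graph n} {S u v} → G ⊑[ S ] H → Reach G S u v → Reach H S u v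
Reach-mono G⊑H (here u∈S)     = here u∈S
Reach-mono G⊑H (step r e v∈S) = step (Reach-mono G⊑H r) (G⊑H (Reach-∈ r) v∈S e) v∈S

Disconnected-antimono : ∀ {G H : Graph n} {S} → G ⊑[ S ] H → Disconnected H S → Disconnected G S
Disconnected-antimono G⊑H disH conG = disH λ u v u∈S v∈S → Reach-mono G⊑H (conG u v u∈S v∈S)

⊑-complete : (G : Graph n) → G ⊑ complete n
⊑-edge (⊑-complete G) {u} {v} e with u ≟ v
... | yes refl with trans (sym e) (irrefl G u)
...   | ()
⊑-edge (⊑-complete G) e | no _ = refl

side : ∀ n₁ → Fin (n₁ + n₂) → Bool
side n₁ x = [ const true , const false ] (splitAt n₁ x)

OnOneSide : ∀ n₁ → Subset (n₁ + n₂) → Set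
OnOneSide n₁ S = ∀ {x y} → x ∈ S → y ∈ S → side n₁ x ≡ side n₁ y

Straddles : ∀ n₁ → Subset (n₁ + n₂) → Set
Straddles n₁ S = ∃₂ λ u v → u ∈ S × v ∈ S × side n₁ u ≢ side n₁ v

avoids⇒onOneSide : ∀ n₁ (S : Subset (n₁ + n₂)) b →
  ¬ ∃ (λ x → x ∈ S × side n₁ x ≡ b) → OnOneSide n₁ S
avoids⇒onOneSide n₁ S b ∄b x∈S y∈S = trans (avoid x∈S) (sym (avoid y∈S))
  where
  avoid : ∀ {x} → x ∈ S → side n₁ x ≡ not b
  avoid {x} x∈S = ¬-not λ xb → ∄b (x , x∈S , xb)

onOneSide⊎straddles : ∀ n₁ (S : Subset (n₁ + n₂)) → OnOneSide n₁ S ⊎ Straddles n₁ S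
onOneSide⊎straddles n₁ S
  with any? (λ x → x ∈? S ×-dec side n₁ x Bool.≟ true)
     | any? (λ x → x ∈? S ×-dec side n₁ x Bool.≟ false)
... | yes (u , u∈S , ut) | yes (v , v∈S , vf) =
  inj₂ (u , v , u∈S , v∈S , λ uv → true≢false (trans (sym ut) (trans uv vf)))
  where
  true≢false : true ≢ false
  true≢false ()
... | no ∄t | _     = inj₁ (avoids⇒onOneSide n₁ S true ∄t)
... | yes _ | no ∄f = inj₁ (avoids⇒onOneSide n₁ S false ∄f)

module _ (G₁ : Graph n₁) (G₂ : Graph n₂) where

  ⊕-adj⇒sameSide : ∀ {u v} → adj (G₁ ⊕ G₂) u v ≡ true → side n₁ u ≡ side n₁ v
  ⊕-adj⇒sameSide {u} {v} e with splitAt n₁ u | splitAt n₁ v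
  ... | inj₁ _ | inj₁ _ = refl
  ... | inj₂ _ | inj₂ _ = refl
  ⊕-adj⇒sameSide () | inj₁ _ | inj₂ _
  ⊕-adj⇒sameSide () | inj₂ _ | inj₁ _

  ⊕-Reach⇒sameSide : ∀ {S u v} → Reach (G₁ ⊕ G₂) S u v → side n₁ u ≡ side n₁ v
  ⊕-Reach⇒sameSide (here _)     = refl
  ⊕-Reach⇒sameSide (step r e _) = trans (⊕-Reach⇒sameSide r) (⊕-adj⇒sameSide e)

  straddles⇒⊕-disconnected : ∀ {S} → Straddles n₁ S → Disconnected (G₁ ⊕ G₂) S
  straddles⇒⊕-disconnected (u , v , u∈S , v∈S , u≁v) con =
    u≁v (⊕-Reach⇒sameSide (con u v u∈S v∈S))

  sameSide⇒⊛-adj≡⊕-adj : ∀ {u v} → side n₁ u ≡ side n₁ v →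
    adj (G₁ ⊛ G₂) u v ≡ adj (G₁ ⊕ G₂) u v
  sameSide⇒⊛-adj≡⊕-adj {u} {v} s with splitAt n₁ u | splitAt n₁ v
  ... | inj₁ _ | inj₁ _ = refl
  ... | inj₂ _ | inj₂ _ = refl
  sameSide⇒⊛-adj≡⊕-adj () | inj₁ _ | inj₂ _
  sameSide⇒⊛-adj≡⊕-adj () | inj₂ _ | inj₁ _

  onOneSide⇒⊛⊑⊕ : ∀ {S} → OnOneSide n₁ S → (G₁ ⊛ G₂) ⊑[ S ] (G₁ ⊕ G₂)
  onOneSide⇒⊛⊑⊕ oneSide u∈S v∈S e = trans (sym (sameSide⇒⊛-adj≡⊕-adj (oneSide u∈S v∈S))) e

  ⊕⊑⊛ : (G₁ ⊕ G₂) ⊑ (G₁ ⊛ G₂)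
  ⊑-edge ⊕⊑⊛ {u} {v} e with splitAt n₁ u | splitAt n₁ v
  ... | inj₁ _ | inj₁ _ = e
  ... | inj₂ _ | inj₂ _ = e
  ... | inj₁ _ | inj₂ _ = refl
  ... | inj₂ _ | inj₁ _ = refl

⊕-mono : ∀ {G₁ H₁ : Graph n₁} {G₂ H₂ : Graph n₂} → G₁ ⊑ H₁ → G₂ ⊑ H₂ → (G₁ ⊕ G₂) ⊑ (H₁ ⊕ H₂)
⊑-edge (⊕-mono {n₁} G₁⊑H₁ G₂⊑H₂) {u} {v} e with splitAt n₁ u | splitAt n₁ v
... | inj₁ _ | inj₁ _ = ⊑-edge G₁⊑H₁ e
... | inj₂ _ | inj₂ _ = ⊑-edge G₂⊑H₂ e
... | inj₁ _ | inj₂ _ = e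
... | inj₂ _ | inj₁ _ = e

⊕-disconnected⇒⊛-or-complete⊕complete : ∀ (G₁ : Graph n₁) (G₂ : Graph n₂) S →
  Disconnected (G₁ ⊕ G₂) S →
  Disconnected (G₁ ⊛ G₂) S ⊎ Disconnected (complete n₁ ⊕ complete n₂) S
⊕-disconnected⇒⊛-or-complete⊕complete {n₁} {n₂} G₁ G₂ S dis with onOneSide⊎straddles n₁ S
... | inj₁ oneSide  = inj₁ (Disconnected-antimono (onOneSide⇒⊛⊑⊕ G₁ G₂ oneSide) dis)
... | inj₂ straddle = inj₂ (straddles⇒⊕-disconnected (complete n₁) (complete n₂) straddle)

⊛-disconnected⇒⊕-disconnected : ∀ (G₁ : Graph n₁) (G₂ : Graph n₂) S →
  Disconnected (G₁ ⊛ G₂) S → Disconnected (G₁ ⊕ G₂) S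
⊛-disconnected⇒⊕-disconnected G₁ G₂ S = Disconnected-antimono (⊑⇒⊑[ S ] (⊕⊑⊛ G₁ G₂))

complete⊕complete-disconnected⇒⊕-disconnected : ∀ (G₁ : Graph n₁) (G₂ : Graph n₂) S →
  Disconnected (complete n₁ ⊕ complete n₂) S → Disconnected (G₁ ⊕ G₂) S
complete⊕complete-disconnected⇒⊕-disconnected G₁ G₂ S =
  Disconnected-antimono (⊑⇒⊑[ S ] (⊕-mono (⊑-complete G₁) (⊑-complete G₂)))

CutFace-map : ∀ {G H : Graph n} {σ} → (∀ S → Disconnected G S → Disconnected H S) →
  CutFace k G σ → CutFace k H σ
CutFace-map f (F , (size , dis) , σ⊆F) = F , (size , f (∁ F) dis) , σ⊆F

CutFace-⊎ : ∀ {G H H′ : Graph n} {σ} →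
  (∀ S → Disconnected G S → Disconnected H S ⊎ Disconnected H′ S) →
  CutFace k G σ → CutFace k H σ ⊎ CutFace k H′ σ
CutFace-⊎ {k = k} {σ = σ} f (F , (size , dis) , σ⊆F) = map face face (f (∁ F) dis)
  where
  face : ∀ {H} → Disconnected H (∁ F) → CutFace k H σ
  face dis = F , (size , dis) , σ⊆F

proposition3p3 : ∀ {n₁ n₂ : ℕ} (G₁ : Graph n₁) (G₂ : Graph n₂) (k : ℕ) → 2 ≤ k →
    ∀ (σ : Subset (n₁ + n₂)) →
    CutFace k (G₁ ⊕ G₂) σ ⇔ (CutFace k (G₁ ⊛ G₂) σ ⊎ CutFace k (complete n₁ ⊕ complete n₂) σ)
proposition3p3 G₁ G₂ k _ σ = mk⇔
  (CutFace-⊎ (⊕-disconnected⇒⊛-or-complete⊕complete G₁ G₂))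
  [ CutFace-map (⊛-disconnected⇒⊕-disconnected G₁ G₂)
  , CutFace-map (complete⊕complete-disconnected⇒⊕-disconnected G₁ G₂)
  ]
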